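{- Let $G$ be a finite graph. Then $G$ is vertex transitive if and only if all the graphs obtained from $G$ by deleting a single vertex are isomorphic to each other.
   Context: A graph is vertex transitive if for every pair of vertices $v_1,v_2$ there is an automorphism (a bijection of the vertex set preserving adjacency and non-adjacency) mapping $v_1$ to $v_2$. -}

module Defs where

open import Data.Nat using (ℕ; zero; suc; pred)
open import Data.Bool using (Bool; false)
open import Data.Fin using (Fin; punchIn)
open import Data.Product using (Σ-syntax; proj₁)
open import Function.Bundles using (_↔_; Inverse)
open import Relation.Binary.PropositionalEquality using (_≡_)

record Graph (n : ℕ) : Set where
  field
    adj    : Fin n → Fin n → Bool
    sym    : ∀ x y → adj x y ≡ adj y x
    irrefl : ∀ x → adj x x ≡ false

open Graph public

Iso : ∀ {n} → Graph n → Graph n → Set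
Iso {n} G H = Σ[ f ∈ (Fin n ↔ Fin n) ]
  (∀ x y → adj H (Inverse.to f x) (Inverse.to f y) ≡ adj G x y)

Aut : ∀ {n} → Graph n → Set
Aut G = Iso G G

VertexTransitive : ∀ {n} → Graph n → Set
VertexTransitive {n} G =
  ∀ (v₁ v₂ : Fin n) → Σ[ σ ∈ Aut G ] Inverse.to (proj₁ σ) v₁ ≡ v₂

delete : ∀ {n} → Graph n → Fin n → Graph (pred n)
delete {suc m} G v = record
  { adj    = λ x y → adj G (punchIn v x) (punchIn v y)
  ; sym    = λ x y → sym G (punchIn v x) (punchIn v y)
  ; irrefl = λ x → irrefl G (punchIn v x)
  }

-- If all vertex-deleted subgraphs are isomorphic, they all have the same number
-- of edges; since deleting u removes exactly deg u edges, G is regular. In a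
-- regular graph an isomorphism G - u ≅ G - v preserves degrees inside the
-- deleted subgraphs, and degree in G is degree in the subgraph plus adjacency
-- to the deleted vertex, so x ~ u exactly when f x ~ v. Hence every such
-- isomorphism extends by u ↦ v to an automorphism of G. Conversely an
-- automorphism mapping u to v restricts to an isomorphism G - u ≅ G - v.
module Submission where

open import Defs
open import Data.Nat using (ℕ; zero; suc; _+_)
open import Data.Nat.Properties
  using (+-0-commutativeMonoid; +-cancelʳ-≡; +-identityʳ; *-cancelˡ-≡; +-assoc)
open import Data.Bool using (Bool; true; false)
open import Data.Sum using (_⊎_; inj₁; inj₂)
open import Data.Fin using (Fin; punchIn; punchOut; _≟_)
open import Data.Fin.Properties using (punchIn-punchOut)
open import Data.Fin.Permutation
  using (Permutation; _⟨$⟩ʳ_; insert; remove; insert-punchIn; punchIn-permute)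
open import Data.Product using (_,_; proj₁; Σ-syntax)
open import Function.Bundles using (_⇔_; mk⇔)
open import Relation.Binary.PropositionalEquality
  using (_≡_; refl; trans; cong; cong₂; module ≡-Reasoning)
  renaming (sym to ≡-sym)
open import Relation.Nullary using (yes; no)
open import Relation.Nullary.Negation using (contradiction)
open import Algebra.Properties.CommutativeMonoid.Sum +-0-commutativeMonoid
  using (sum; sum-cong-≗; sum-remove; sum-permute; ∑-distrib-+)

open ≡-Reasoning

punchIn-view : ∀ {m} (u y : Fin (suc m)) → y ≡ u ⊎ Σ[ x ∈ Fin m ] y ≡ punchIn u x
punchIn-view u y with u ≟ y
... | yes u≡y = inj₁ (≡-sym u≡y)
... | no u≢y  = inj₂ (punchOut u≢y , ≡-sym (punchIn-punchOut u≢y))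

insert-self : ∀ {m n} i j (π : Permutation m n) → insert i j π ⟨$⟩ʳ i ≡ j
insert-self i j π with i ≟ i
... | yes _  = refl
... | no i≢i = contradiction refl i≢i

+-double-injective : ∀ m n → m + m ≡ n + n → m ≡ n
+-double-injective m n m+m≡n+n = *-cancelˡ-≡ m n 2 (begin
  m + (m + 0) ≡⟨ cong (m +_) (+-identityʳ m) ⟩
  m + m       ≡⟨ m+m≡n+n ⟩
  n + n       ≡⟨ cong (n +_) (+-identityʳ n) ⟨
  n + (n + 0) ∎)

indicator : Bool → ℕ
indicator false = 0
indicator true  = 1

indicator-injective : ∀ {a b} → indicator a ≡ indicator b → a ≡ b
indicator-injective {false} {false} _ = refl
indicator-injective {true}  {true}  _ = refl

degree : ∀ {n} → Graph n → Fin n → ℕ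
degree G x = sum λ y → indicator (adj G x y)

degreeSum : ∀ {n} → Graph n → ℕ
degreeSum G = sum (degree G)

Regular : ∀ {n} → Graph n → Set
Regular {n} G = ∀ (u v : Fin n) → degree G u ≡ degree G v

Iso-preserves-degree : ∀ {n} {G H : Graph n} (iso : Iso G H) x →
  degree H (proj₁ iso ⟨$⟩ʳ x) ≡ degree G x
Iso-preserves-degree {H = H} (f , f-preserves) x =
  trans (sum-permute (λ y → indicator (adj H (f ⟨$⟩ʳ x) y)) f)
        (sum-cong-≗ λ y → cong indicator (f-preserves x y))

Iso-preserves-degreeSum : ∀ {n} {G H : Graph n} → Iso G H → degreeSum H ≡ degreeSum G
Iso-preserves-degreeSum {G = G} {H = H} iso@(f , _) =
  trans (sum-permute (degree H) f) (sum-cong-≗ (Iso-preserves-degree {G = G} {H = H} iso))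

module _ {m} (G : Graph (suc m)) where

  degree-punchIn : ∀ u x →
    degree G (punchIn u x) ≡ indicator (adj G (punchIn u x) u) + degree (delete G u) x
  degree-punchIn u x = sum-remove {i = u} λ y → indicator (adj G (punchIn u x) y)

  degree-by-punchIn : ∀ u → degree G u ≡ sum λ x → indicator (adj G (punchIn u x) u)
  degree-by-punchIn u = begin
    degree G u
      ≡⟨ sum-remove {i = u} (λ y → indicator (adj G u y)) ⟩
    indicator (adj G u u) + sum (λ x → indicator (adj G u (punchIn u x)))
      ≡⟨ cong (λ b → indicator b + sum (λ x → indicator (adj G u (punchIn u x)))) (irrefl G u) ⟩
    sum (λ x → indicator (adj G u (punchIn u x)))
      ≡⟨ sum-cong-≗ (λ x → cong indicator (sym G u (punchIn u x))) ⟩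
    sum (λ x → indicator (adj G (punchIn u x) u))
      ∎

  degreeSum-delete : ∀ u → degreeSum G ≡ degree G u + degree G u + degreeSum (delete G u)
  degreeSum-delete u = begin
    degreeSum G
      ≡⟨ sum-remove {i = u} (degree G) ⟩
    degree G u + sum (λ x → degree G (punchIn u x))
      ≡⟨ cong (degree G u +_) (sum-cong-≗ (degree-punchIn u)) ⟩
    degree G u + sum (λ x → indicator (adj G (punchIn u x) u) + degree (delete G u) x)
      ≡⟨ cong (degree G u +_) (∑-distrib-+ (λ x → indicator (adj G (punchIn u x) u))
                                            (degree (delete G u))) ⟩
    degree G u + (sum (λ x → indicator (adj G (punchIn u x) u)) + degreeSum (delete G u))
      ≡⟨ cong (λ d → degree G u + (d + degreeSum (delete G u))) (degree-by-punchIn u) ⟨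
    degree G u + (degree G u + degreeSum (delete G u))
      ≡⟨ +-assoc (degree G u) _ _ ⟨
    degree G u + degree G u + degreeSum (delete G u)
      ∎

  deletions-isomorphic⇒regular : (∀ u v → Iso (delete G u) (delete G v)) → Regular G
  deletions-isomorphic⇒regular deletions-iso u v =
    +-double-injective (degree G u) (degree G v) (+-cancelʳ-≡ (degreeSum (delete G u)) _ _ (begin
      degree G u + degree G u + degreeSum (delete G u)  ≡⟨ degreeSum-delete u ⟨
      degreeSum G                                       ≡⟨ degreeSum-delete v ⟩
      degree G v + degree G v + degreeSum (delete G v)
        ≡⟨ cong (degree G v + degree G v +_)
                (Iso-preserves-degreeSum {G = delete G u} {H = delete G v} (deletions-iso u v)) ⟩
      degree G v + degree G v + degreeSum (delete G u)  ∎))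

  Regular⇒Iso-delete-preserves-adj : Regular G → ∀ {u v} (iso : Iso (delete G u) (delete G v)) →
    let f = proj₁ iso in ∀ x → adj G (punchIn u x) u ≡ adj G (punchIn v (f ⟨$⟩ʳ x)) v
  Regular⇒Iso-delete-preserves-adj regular {u} {v} iso@(f , _) x =
    indicator-injective (+-cancelʳ-≡ (degree (delete G u) x) _ _ (begin
      indicator (adj G (punchIn u x) u) + degree (delete G u) x        ≡⟨ degree-punchIn u x ⟨
      degree G (punchIn u x)                                           ≡⟨ regular _ _ ⟩
      degree G (punchIn v (f ⟨$⟩ʳ x))                                  ≡⟨ degree-punchIn v _ ⟩
      indicator (adj G (punchIn v (f ⟨$⟩ʳ x)) v) + degree (delete G v) (f ⟨$⟩ʳ x)
        ≡⟨ cong (indicator (adj G (punchIn v (f ⟨$⟩ʳ x)) v) +_)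
                (Iso-preserves-degree {G = delete G u} {H = delete G v} iso x) ⟩
      indicator (adj G (punchIn v (f ⟨$⟩ʳ x)) v) + degree (delete G u) x ∎))

  Regular⇒Iso-delete-extends : Regular G → ∀ {u v} → Iso (delete G u) (delete G v) →
    Σ[ σ ∈ Aut G ] proj₁ σ ⟨$⟩ʳ u ≡ v
  Regular⇒Iso-delete-extends regular {u} {v} iso@(f , f-preserves) =
    (σ , σ-preserves) , insert-self u v f
    where
    σ : Permutation (suc m) (suc m)
    σ = insert u v f

    adj-deleted : ∀ x → adj G (punchIn u x) u ≡ adj G (punchIn v (f ⟨$⟩ʳ x)) v
    adj-deleted = Regular⇒Iso-delete-preserves-adj regular iso

    σ-preserves : ∀ y z → adj G (σ ⟨$⟩ʳ y) (σ ⟨$⟩ʳ z) ≡ adj G y z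
    σ-preserves y z with punchIn-view u y | punchIn-view u z
    ... | inj₁ refl | inj₁ refl rewrite insert-self u v f = trans (irrefl G v) (≡-sym (irrefl G u))
    ... | inj₁ refl | inj₂ (x , refl) rewrite insert-self u v f | insert-punchIn u v f x =
      trans (sym G v _) (trans (≡-sym (adj-deleted x)) (sym G _ u))
    ... | inj₂ (x , refl) | inj₁ refl rewrite insert-self u v f | insert-punchIn u v f x =
      ≡-sym (adj-deleted x)
    ... | inj₂ (x , refl) | inj₂ (x′ , refl) rewrite insert-punchIn u v f x | insert-punchIn u v f x′ =
      f-preserves x x′

  Aut-restricts : ((σ , σ-preserves) : Aut G) (u : Fin (suc m)) →
    Iso (delete G u) (delete G (σ ⟨$⟩ʳ u))
  Aut-restricts (σ , σ-preserves) u = remove u σ , λ x y → begin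
    adj G (punchIn (σ ⟨$⟩ʳ u) (remove u σ ⟨$⟩ʳ x)) (punchIn (σ ⟨$⟩ʳ u) (remove u σ ⟨$⟩ʳ y))
      ≡⟨ cong₂ (adj G) (punchIn-permute σ u x) (punchIn-permute σ u y) ⟨
    adj G (σ ⟨$⟩ʳ punchIn u x) (σ ⟨$⟩ʳ punchIn u y)  ≡⟨ σ-preserves (punchIn u x) (punchIn u y) ⟩
    adj G (punchIn u x) (punchIn u y)                 ∎

  VertexTransitive⇔deletions-isomorphic :
    VertexTransitive G ⇔ (∀ u v → Iso (delete G u) (delete G v))
  VertexTransitive⇔deletions-isomorphic = mk⇔ restrict extend
    where
    restrict : VertexTransitive G → ∀ u v → Iso (delete G u) (delete G v)
    restrict transitive u v with transitive u v
    ... | σ , refl = Aut-restricts σ u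

    extend : (∀ u v → Iso (delete G u) (delete G v)) → VertexTransitive G
    extend deletions-iso u v =
      Regular⇒Iso-delete-extends (deletions-isomorphic⇒regular deletions-iso) (deletions-iso u v)

corollary3p3 : ∀ {n : ℕ} (G : Graph n) →
    VertexTransitive G ⇔ (∀ (u v : Fin n) → Iso (delete G u) (delete G v))
corollary3p3 {zero}  G = mk⇔ (λ _ ()) (λ _ ())
corollary3p3 {suc m} G = VertexTransitive⇔deletions-isomorphic G
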